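{- There is a minion homomorphism $\chi\colon \mathrm{Pol}(\mathrm{LO}_3, \mathrm{LO}_4) \to \mathscr{Z}_3$, where $\mathscr{Z}_3$ denotes the minion of affine maps over $\mathbb Z_3$.
   Context: For $k\in\mathbb N$, $\mathrm{LO}_k$ is the relational structure with domain $\{1,\dots,k\}$ and one ternary relation consisting of exactly those triples $(a,b,c)$ that contain a unique maximum (i.e., $a=b<c$, $a=c<b$, $b=c<a$, or $a,b,c$ pairwise distinct). For structures $\mathbf A,\mathbf B$, the $n$-fold power $\mathbf A^n$ has domain $A^n$ with relations defined coordinatewise, and an $n$-ary polymorphism from $\mathbf A$ to $\mathbf B$ is a homomorphism $\mathbf A^n\to\mathbf B$. For $f\colon A^n\to B$ and $\pi\colon[n]\to[m]$, the $\pi$-minor of $f$ is $f^\pi\colon A^m\to B$, $f^\pi(x_1,\dots,x_m)=f(x_{\pi(1)},\dots,x_{\pi(n)})$. An (abstract) minion $\mathscr M$ is a collection of sets $\mathscr M^{(n)}$, $n>0$, with maps $\pi^{\mathscr M}\colon\mathscr M^{(n)}\to\mathscr M^{(m)}$ for each $\pi\colon[n]\to[m]$, compatible with composition and identities; $\mathrm{Pol}(\mathbf A,\mathbf B)$ is the minion with $\mathrm{Pol}(\mathbf A,\mathbf B)^{(n)}$ the $n$-ary polymorphisms and $\pi$ acting by taking $\pi$-minors. A minion homomorphism $\xi\colon\mathscr M\to\mathscr N$ is a collection of maps $\xi_n\colon\mathscr M^{(n)}\to\mathscr N^{(n)}$ preserving minors, i.e., $\xi_m\circ\pi^{\mathscr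 M}=\pi^{\mathscr N}\circ\xi_n$ for every $\pi\colon[n]\to[m]$. The minion $\mathscr Z_3$ of affine maps over $\mathbb Z_3$ has as $n$-ary elements the maps $\mathbb Z_3^n\to\mathbb Z_3$ of the form $(x_1,\dots,x_n)\mapsto\sum_{i=1}^n\alpha_i x_i$ with fixed $\alpha_1,\dots,\alpha_n\in\mathbb Z_3$ satisfying $\sum_{i=1}^n\alpha_i\equiv 1\pmod 3$, with minors taken as $\pi$-minors of these functions. -}

module Defs where

open import Data.Nat using (ℕ; zero; suc)
open import Data.Nat.DivMod using (_mod_)
open import Data.Fin using (Fin; zero; suc; toℕ; _<_)
open import Data.Product using (Σ; _×_; _,_; proj₁; proj₂)
open import Data.Sum using (_⊎_)
open import Relation.Binary.PropositionalEquality using (_≡_; _≢_)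
import Data.Nat as ℕ

-- The relation of LO_k: triples (a,b,c) over {1..k} (here Fin k, order preserved)
-- with a unique maximum.
LO : (k : ℕ) → Fin k → Fin k → Fin k → Set
LO k a b c =
    (a ≡ b × a < c)
  ⊎ (a ≡ c × a < b)
  ⊎ (b ≡ c × b < a)
  ⊎ (a ≢ b × a ≢ c × b ≢ c)

IsPolymorphism : (k l n : ℕ) → ((Fin n → Fin k) → Fin l) → Set
IsPolymorphism k l n f =
  (x y z : Fin n → Fin k) → (∀ i → LO k (x i) (y i) (z i)) → LO l (f x) (f y) (f z)

Pol : (k l n : ℕ) → Set
Pol k l n = Σ ((Fin n → Fin k) → Fin l) (IsPolymorphism k l n)

polMinor : {k l n m : ℕ} → (Fin n → Fin m) → Pol k l n → Pol k l m
polMinor π (f , p) =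
  (λ x → f (λ i → x (π i))) , λ x y z h → p (λ i → x (π i)) (λ i → y (π i)) (λ i → z (π i)) (λ i → h (π i))

_+₃_ : Fin 3 → Fin 3 → Fin 3
a +₃ b = (toℕ a ℕ.+ toℕ b) mod 3

_*₃_ : Fin 3 → Fin 3 → Fin 3
a *₃ b = (toℕ a ℕ.* toℕ b) mod 3

sum₃ : {n : ℕ} → (Fin n → Fin 3) → Fin 3
sum₃ {zero} v = zero
sum₃ {suc n} v = v zero +₃ sum₃ (λ i → v (suc i))

-- n-ary elements of 𝒵₃: coefficient vectors α with Σ αᵢ ≡ 1 (mod 3),
-- standing for the affine map x ↦ Σ αᵢ xᵢ
Z3 : ℕ → Set
Z3 n = Σ (Fin n → Fin 3) (λ α → sum₃ α ≡ suc zero)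

affineMap : {n : ℕ} → Z3 n → (Fin n → Fin 3) → Fin 3
affineMap (α , _) x = sum₃ (λ i → α i *₃ x i)

-- a minion homomorphism Pol(LO_k, LO_l) → 𝒵₃ (arities n > 0, written suc n):
-- maps ξₙ preserving minors, where equality in 𝒵₃ is equality of the maps
-- ℤ₃ᵐ → ℤ₃ (pointwise), and the π-minor of g is y ↦ g(y ∘ π).
IsMinionHom : (k l : ℕ) → ((n : ℕ) → Pol k l (suc n) → Z3 (suc n)) → Set
IsMinionHom k l ξ =
  (n m : ℕ) (π : Fin (suc n) → Fin (suc m)) (f : Pol k l (suc n)) →
  (y : Fin (suc m) → Fin 3) →
  affineMap (ξ m (polMinor π f)) y ≡ affineMap (ξ n f) (λ i → y (π i))

MinionHom : (k l : ℕ) → Set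
MinionHom k l = Σ ((n : ℕ) → Pol k l (suc n) → Z3 (suc n)) (IsMinionHom k l)

-- For a polymorphism f : LO₃ⁿ → LO₄ and a set S of coordinates, favours f S ∈ {0, 1} ⊆ ℤ₃
-- records whether f gives the indicator tuple of S a larger colour than the indicator of its
-- complement.  A finite check over ternary minors shows that favours f sums to 1 over every
-- partition of the coordinates into three blocks.  Hence favours f is additive on disjoint sets,
-- so it is determined by its values αₖ on singletons; these sum to 1 because f is monotone,
-- and the π-minor of f gets the coefficients Σ_{π i = j} αᵢ, which are those of the π-minor
-- of the affine map Σ αᵢ xᵢ.

module Submission where

open import Defs

open import Algebra.Bundles using (Monoid; Semiring; CommutativeSemiring)
open import Algebra.Structures.Biased using (isCommutativeSemiringˡ)
open import Data.Bool using (Bool; true; false; T; not; _∧_; _∨_; if_then_else_)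
open import Data.Bool.ListAction using (all; any)
open import Data.Bool.Properties using (T-∨; T-≡; ∧-zeroʳ; ∨-identityʳ)
open import Data.Empty using (⊥-elim)
open import Data.Fin using (Fin; zero; suc; _<_; _<?_; _≟_)
open import Data.Fin.Properties using (all?; <-irrefl; <-asym)
open import Data.List using (List; []; _∷_; [_]; allFin; map; drop; concatMap; zip; upTo; length; reverse)
open import Data.List.Membership.Propositional.Properties using (∈-allFin)
open import Data.List.Relation.Unary.All as All using (All; []; _∷_)
open import Data.List.Relation.Unary.All.Properties using (all⁺; drop⁺)
open import Data.List.Relation.Unary.Any using (satisfied)
open import Data.List.Relation.Unary.Any.Properties using (any⁻)
open import Data.Nat as ℕ using (ℕ)
open import Data.Product using (_×_; _,_; proj₁; proj₂; ∃-syntax)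
open import Data.Sum using (inj₁; inj₂; [_,_]′)
import Data.Vec.Functional as Vector
open import Function using (_∘_; Equivalence)
open import Level using (_⊔_; 0ℓ)
open import Relation.Binary.PropositionalEquality
  using (_≡_; _≗_; refl; sym; trans; cong; cong₂; subst; isEquivalence; module ≡-Reasoning)
open import Relation.Nullary using (¬_)
open import Relation.Nullary.Decidable
  using ( Dec; yes; no; does; isYes; map′; from-yes; toWitness; dec-true; dec-false
        ; ¬?; _×-dec_; _⊎-dec_; _→-dec_)

pattern 0₃ = zero
pattern 1₃ = suc zero
pattern 2₃ = suc (suc zero)

LO? : ∀ k (a b c : Fin k) → Dec (LO k a b c)
LO? k a b c = (a ≟ b ×-dec a <? c) ⊎-dec (a ≟ c ×-dec a <? b) ⊎-dec (b ≟ c ×-dec b <? a)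
            ⊎-dec (¬? (a ≟ b) ×-dec ¬? (a ≟ c) ×-dec ¬? (b ≟ c))

LO-diagonal : ∀ {k} {a c : Fin k} → LO k a a c → a < c
LO-diagonal (inj₁ (_ , a<c))                   = a<c
LO-diagonal (inj₂ (inj₁ (refl , a<a)))         = ⊥-elim (<-irrefl refl a<a)
LO-diagonal (inj₂ (inj₂ (inj₁ (refl , a<a))))  = ⊥-elim (<-irrefl refl a<a)
LO-diagonal (inj₂ (inj₂ (inj₂ (a≢a , _))))     = ⊥-elim (a≢a refl)

polymorphism-monotone : ∀ {k l n f} → IsPolymorphism k l n f →
                        ∀ {x y} → (∀ i → x i < y i) → f x < f y
polymorphism-monotone f-poly x<y = LO-diagonal (f-poly _ _ _ λ i → inj₁ (refl , x<y i))

module HomomorphismSearch {A : Set} {m : ℕ}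
  (R : A → A → A → Set) (R? : ∀ x y z → Dec (R x y z))
  (S : Fin m → Fin m → Fin m → Set) (S? : ∀ a b c → Dec (S a b c)) where

  Assignment : Set
  Assignment = List (A × Fin m)

  -- An assignment lists its newest entry first.  A constraint to be checked against the
  -- newest entry (x , a) is a pair of offsets (i , j) naming entries (y , b) and (z , c);
  -- it fails when R x y z holds but S a b c does not.
  Offsets : Set
  Offsets = List (ℕ × ℕ)

  clash : A × Fin m → Assignment → Assignment → Bool
  clash (x , a) ((y , b) ∷ _) ((z , c) ∷ _) = not (does (S? a b c)) ∧ does (R? x y z)
  clash _       _             _             = false

  violates : Assignment → ℕ × ℕ → Bool
  violates []           _       = false
  violates ρ@(xa ∷ _) (i , j) = clash xa (drop i ρ) (drop j ρ)

  explore : List (A × Offsets) → Assignment → (Assignment → List (Fin m) → Bool) → Bool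
  explore []              ρ k = k ρ []
  explore ((x , os) ∷ xs) ρ k = all branch (allFin m)
    where
    branch : Fin m → Bool
    branch a = any (violates ((x , a) ∷ ρ)) os
             ∨ explore xs ((x , a) ∷ ρ) (λ σ as → k σ (a ∷ as))

  -- Soundness does not depend on which offsets are checked; these are the pairs
  -- related to the new point by R, so that no node tests a constraint that cannot fail.
  annotate : List A → List A → List (A × Offsets)
  annotate prior []       = []
  annotate prior (x ∷ xs) = (x , related) ∷ annotate (x ∷ prior) xs
    where
    indexed : List (ℕ × A)
    indexed = zip (upTo (length (x ∷ prior))) (x ∷ prior)
    related : Offsets
    related = concatMap (λ (i , y) →
                concatMap (λ (j , z) → if does (R? x y z) then [ i , j ] else [])
                          (drop i indexed))
              indexed

  module Soundness (g : A → Fin m) (g-hom : ∀ {x y z} → R x y z → S (g x) (g y) (g z)) where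

    Agrees : Assignment → Set
    Agrees = All λ (x , a) → g x ≡ a

    clash-sound : ∀ {x a ρ σ} → g x ≡ a → Agrees ρ → Agrees σ → ¬ T (clash (x , a) ρ σ)
    clash-sound {x} {ρ = (y , _) ∷ _} {(z , _) ∷ _} refl (refl ∷ _) (refl ∷ _) t
      with S? (g x) (g y) (g z) | R? x y z
    ... | yes _ | _     = t
    ... | no  _ | no  _ = t
    ... | no ¬s | yes r = ¬s (g-hom r)

    violates-sound : ∀ {ρ} → Agrees ρ → ∀ o → ¬ T (violates ρ o)
    violates-sound ag@(gx≡a ∷ _) (i , j) = clash-sound gx≡a (drop⁺ i ag) (drop⁺ j ag)

    -- Stated with ≡ true rather than T: Agda would evaluate the whole search again
    -- whenever it checks a certificate against a type T (explore …).
    explore-sound : ∀ xs {ρ k} → Agrees ρ → explore xs ρ k ≡ true →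
                    ∃[ σ ] Agrees σ × k σ (map (g ∘ proj₁) xs) ≡ true
    explore-sound []              ag e = _ , ag , e
    explore-sound ((x , os) ∷ xs) {ρ} ag e
      with Equivalence.to (T-∨ {any (violates ((x , g x) ∷ ρ)) os})
             (All.lookup (all⁺ _ _ (Equivalence.from T-≡ e)) (∈-allFin (g x)))
    ... | inj₁ v = let o , bad = satisfied (any⁻ _ os v) in ⊥-elim (violates-sound (refl ∷ ag) o bad)
    ... | inj₂ e′ = explore-sound xs (refl ∷ ag) (Equivalence.to T-≡ e′)

ℤ₃ : CommutativeSemiring 0ℓ 0ℓ
ℤ₃ = record
  { Carrier = Fin 3 ; _≈_ = _≡_ ; _+_ = _+₃_ ; _*_ = _*₃_ ; 0# = 0₃ ; 1# = 1₃
  ; isCommutativeSemiring = isCommutativeSemiringˡ record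
    { +-isCommutativeMonoid = record
      { isMonoid = record
        { isSemigroup = record
          { isMagma = record { isEquivalence = isEquivalence ; ∙-cong = cong₂ _+₃_ }
          ; assoc = from-yes (all? λ a → all? λ b → all? λ c → ((a +₃ b) +₃ c) ≟ (a +₃ (b +₃ c))) }
        ; identity = from-yes (all? λ a → (0₃ +₃ a) ≟ a) , from-yes (all? λ a → (a +₃ 0₃) ≟ a) }
      ; comm = from-yes (all? λ a → all? λ b → (a +₃ b) ≟ (b +₃ a)) }
    ; *-isCommutativeMonoid = record
      { isMonoid = record
        { isSemigroup = record
          { isMagma = record { isEquivalence = isEquivalence ; ∙-cong = cong₂ _*₃_ }
          ; assoc = from-yes (all? λ a → all? λ b → all? λ c → ((a *₃ b) *₃ c) ≟ (a *₃ (b *₃ c))) }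
        ; identity = from-yes (all? λ a → (1₃ *₃ a) ≟ a) , from-yes (all? λ a → (a *₃ 1₃) ≟ a) }
      ; comm = from-yes (all? λ a → all? λ b → (a *₃ b) ≟ (b *₃ a)) }
    ; distribʳ = from-yes (all? λ a → all? λ b → all? λ c → ((b +₃ c) *₃ a) ≟ ((b *₃ a) +₃ (c *₃ a)))
    ; zeroˡ = from-yes (all? λ a → (0₃ *₃ a) ≟ 0₃)
    }
  }

+₃-cancelʳ : ∀ a b c → a +₃ c ≡ b +₃ c → a ≡ b
+₃-cancelʳ = from-yes (all? λ a → all? λ b → all? λ c → ((a +₃ c) ≟ (b +₃ c)) →-dec (a ≟ b))

∅ : ∀ {n} → Fin n → Bool
∅ _ = false

⁅_⁆ : ∀ {n} → Fin n → Fin n → Bool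
⁅ k ⁆ i = does (i ≟ k)

_∪_ : ∀ {n} → (Fin n → Bool) → (Fin n → Bool) → Fin n → Bool
(S ∪ S′) i = S i ∨ S′ i

Disjoint : ∀ {n} → (Fin n → Bool) → (Fin n → Bool) → Set
Disjoint S S′ = ∀ i → S i ∧ S′ i ≡ false

module AdditiveSetFunctions {c ℓ} (M : Monoid c ℓ) where

  open Monoid M using (Carrier; _≈_; setoid)
    renaming (_∙_ to _+_; ε to 0#; ∙-cong to +-cong; ∙-congˡ to +-congˡ; refl to ≈-refl; trans to ≈-trans)
  open import Algebra.Properties.Monoid.Sum M using (sum; sum-cong-≋)
  open import Relation.Binary.Reasoning.Setoid setoid

  record IsAdditive {n} (μ : (Fin n → Bool) → Carrier) : Set (c ⊔ ℓ) where
    field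
      cong-≗ : ∀ {S S′} → S ≗ S′ → μ S ≈ μ S′
      empty  : μ ∅ ≈ 0#
      union  : ∀ {S S′} → Disjoint S S′ → μ (S ∪ S′) ≈ μ S + μ S′

  additive⇒sum : ∀ {n μ} → IsAdditive {n} μ → ∀ S → μ S ≈ sum (λ i → if S i then μ ⁅ i ⁆ else 0#)
  additive⇒sum {ℕ.zero}  μ-add S = ≈-trans (cong-≗ λ ()) empty
    where open IsAdditive μ-add
  additive⇒sum {ℕ.suc n} {μ} μ-add S = begin
    μ S          ≈⟨ cong-≗ split ⟩
    μ (S₀ ∪ S₊)  ≈⟨ union disjoint ⟩
    μ S₀ + μ S₊  ≈⟨ +-cong (at-zero (S zero)) (additive⇒sum shifted (Vector.tail S)) ⟩
    (if S zero then μ ⁅ zero ⁆ else 0#) + sum (λ j → if S (suc j) then μ (false Vector.∷ ⁅ j ⁆) else 0#)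
                 ≈⟨ +-congˡ (sum-cong-≋ λ j → if-cong (S (suc j)) (cong-≗ (shift-⁅⁆ j))) ⟩
    sum (λ i → if S i then μ ⁅ i ⁆ else 0#)  ∎
    where
    open IsAdditive μ-add
    S₀ S₊ : Fin (ℕ.suc n) → Bool
    S₀ = S zero Vector.∷ ∅
    S₊ = false Vector.∷ Vector.tail S
    split : S ≗ S₀ ∪ S₊
    split zero    = sym (∨-identityʳ (S zero))
    split (suc i) = refl
    disjoint : Disjoint S₀ S₊
    disjoint zero    = ∧-zeroʳ (S zero)
    disjoint (suc i) = refl
    at-zero : ∀ b → μ (b Vector.∷ ∅) ≈ (if b then μ ⁅ zero ⁆ else 0#)
    at-zero true  = cong-≗ λ { zero → refl ; (suc _) → refl }
    at-zero false = ≈-trans (cong-≗ λ { zero → refl ; (suc _) → refl }) empty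
    shifted : IsAdditive (λ S′ → μ (false Vector.∷ S′))
    shifted = record
      { cong-≗ = λ S≗S′ → cong-≗ λ { zero → refl ; (suc i) → S≗S′ i }
      ; empty  = ≈-trans (cong-≗ λ { zero → refl ; (suc _) → refl }) empty
      ; union  = λ d → ≈-trans (cong-≗ λ { zero → refl ; (suc _) → refl })
                                (union λ { zero → refl ; (suc i) → d i })
      }
    shift-⁅⁆ : ∀ j → (false Vector.∷ ⁅ j ⁆) ≗ ⁅ suc j ⁆
    shift-⁅⁆ j zero    = refl
    shift-⁅⁆ j (suc i) = refl
    if-cong : ∀ b {x y} → x ≈ y → (if b then x else 0#) ≈ (if b then y else 0#)
    if-cong true  x≈y = x≈y
    if-cong false _   = ≈-refl

module SemiringSums {c ℓ} (R : Semiring c ℓ) where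

  open Semiring R
    using (Carrier; _≈_; _+_; _*_; 0#; setoid; +-congˡ; +-congʳ; +-identityˡ; +-identityʳ; zeroˡ)
    renaming (trans to ≈-trans)
  open import Algebra.Properties.Semiring.Sum R using (sum; sum-cong-≋; sum-replicate-zero; ∑-comm; *-distribʳ-sum)
  open import Relation.Binary.Reasoning.Setoid setoid

  ∑-δ : ∀ {m} (k : Fin m) x (y : Fin m → Carrier) →
        sum (λ j → (if ⁅ j ⁆ k then x else 0#) * y j) ≈ x * y k
  ∑-δ {ℕ.suc m} zero x y = begin
    x * y zero + sum (λ j → 0# * y (suc j)) ≈⟨ +-congˡ (≈-trans (sum-cong-≋ λ j → zeroˡ (y (suc j)))
                                                              (sum-replicate-zero m)) ⟩
    x * y zero + 0#                         ≈⟨ +-identityʳ _ ⟩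
    x * y zero                              ∎
  ∑-δ {ℕ.suc m} (suc k) x y = begin
    0# * y zero + sum (λ j → (if ⁅ j ⁆ k then x else 0#) * y (suc j)) ≈⟨ +-congʳ (zeroˡ (y zero)) ⟩
    0# + sum (λ j → (if ⁅ j ⁆ k then x else 0#) * y (suc j))          ≈⟨ +-identityˡ _ ⟩
    sum (λ j → (if ⁅ j ⁆ k then x else 0#) * y (suc j))               ≈⟨ ∑-δ k x (y ∘ suc) ⟩
    x * y (suc k)                                                   ∎

  ∑-fibres : ∀ {n m} (π : Fin n → Fin m) (α : Fin n → Carrier) (y : Fin m → Carrier) →
             sum (λ j → sum (λ i → if ⁅ j ⁆ (π i) then α i else 0#) * y j) ≈ sum (λ i → α i * y (π i))
  ∑-fibres {n} {m} π α y = begin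
    sum (λ j → sum (λ i → a j i) * y j)     ≈⟨ sum-cong-≋ (λ j → *-distribʳ-sum (y j) (a j)) ⟩
    sum (λ j → sum (λ i → a j i * y j))     ≈⟨ ∑-comm (λ j i → a j i * y j) ⟩
    sum (λ i → sum (λ j → a j i * y j))     ≈⟨ sum-cong-≋ (λ i → ∑-δ (π i) (α i) y) ⟩
    sum (λ i → α i * y (π i))               ∎
    where
    a : Fin m → Fin n → Carrier
    a j i = if ⁅ j ⁆ (π i) then α i else 0#

bit : Bool → Fin 3
bit b = if b then 1₃ else 0₃

⟦_<_⟧ : ∀ {k} → Fin k → Fin k → Fin 3
⟦ a < b ⟧ = bit (does (a <? b))

favours : ∀ {n} → ((Fin n → Fin 3) → Fin 4) → (Fin n → Bool) → Fin 3
favours f S = ⟦ f (bit ∘ not ∘ S) < f (bit ∘ S) ⟧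

data OneHot : Bool → Bool → Bool → Set where
  first  : OneHot true  false false
  second : OneHot false true  false
  third  : OneHot false false true

oneHot-∁ : ∀ b → OneHot b false (not b)
oneHot-∁ true  = first
oneHot-∁ false = third

oneHot-∪ : ∀ a b → a ∧ b ≡ false → OneHot a b (not (a ∨ b))
oneHot-∪ true  false _ = first
oneHot-∪ false true  _ = second
oneHot-∪ false false _ = third

-- A shape is a tuple that is constant on each block of a partition (A , B , C), given as a
-- function of the membership bits; this makes the indicator tuples bit ∘ A and bit ∘ not ∘ A
-- values of shapes up to β-reduction.
Shape : Set
Shape = Bool → Bool → Bool → Fin 3

Compatible : Shape → Shape → Shape → Set
Compatible h₁ h₂ h₃ = ∀ {a b c} → OneHot a b c → LO 3 (h₁ a b c) (h₂ a b c) (h₃ a b c)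

compatible? : ∀ h₁ h₂ h₃ → Dec (Compatible h₁ h₂ h₃)
compatible? h₁ h₂ h₃ =
  map′ (λ (p , q , r) → λ { first → p ; second → q ; third → r })
       (λ h → h first , h second , h third)
       (at true false false ×-dec at false true false ×-dec at false false true)
  where
  at : ∀ a b c → Dec (LO 3 (h₁ a b c) (h₂ a b c) (h₃ a b c))
  at a b c = LO? 3 (h₁ a b c) (h₂ a b c) (h₃ a b c)

open HomomorphismSearch Compatible compatible? (LO 4) (LO? 4)

⟨_∣_∣_⟩ : Fin 3 → Fin 3 → Fin 3 → Shape
⟨ x ∣ y ∣ z ⟩ a b c = if a then x else if b then y else z

-- The six indicator shapes at the end of phase₁ are the ones sumsToOne reads; the other
-- shapes are just enough to refute every assignment on which the sum is not 1.
phase₁ phase₂ : List Shape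
phase₁ = ⟨ 2₃ ∣ 2₃ ∣ 1₃ ⟩ ∷ ⟨ 0₃ ∣ 0₃ ∣ 2₃ ⟩ ∷ ⟨ 0₃ ∣ 2₃ ∣ 0₃ ⟩
       ∷ (λ a _ _ → bit a) ∷ (λ a _ _ → bit (not a))
       ∷ (λ _ b _ → bit b) ∷ (λ _ b _ → bit (not b))
       ∷ (λ _ _ c → bit c) ∷ (λ _ _ c → bit (not c)) ∷ []
phase₂ = ⟨ 1₃ ∣ 2₃ ∣ 2₃ ⟩ ∷ ⟨ 2₃ ∣ 0₃ ∣ 0₃ ⟩ ∷ ⟨ 2₃ ∣ 1₃ ∣ 2₃ ⟩ ∷ []

sumsToOne : List (Fin 4) → Bool
sumsToOne (_ ∷ _ ∷ _ ∷ e₀ ∷ ē₀ ∷ e₁ ∷ ē₁ ∷ e₂ ∷ ē₂ ∷ []) =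
  isYes (((⟦ ē₀ < e₀ ⟧ +₃ ⟦ ē₁ < e₁ ⟧) +₃ ⟦ ē₂ < e₂ ⟧) ≟ 1₃)
sumsToOne _ = false

refutes : Assignment → Bool
refutes σ = explore (annotate (reverse phase₁) phase₂) σ (λ _ _ → false)

verdict : Assignment → List (Fin 4) → Bool
verdict σ vs = sumsToOne vs ∨ refutes σ

certificate : explore (annotate [] phase₁) [] verdict ≡ true
certificate = refl

open CommutativeSemiring ℤ₃ using (+-monoid; semiring; +-identityʳ)
open AdditiveSetFunctions +-monoid
open SemiringSums semiring
open import Algebra.Properties.Semiring.Sum semiring using (sum; sum-cong-≗)

sum₃≡sum : ∀ {n} (v : Fin n → Fin 3) → sum₃ v ≡ sum v
sum₃≡sum {ℕ.zero}  v = refl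
sum₃≡sum {ℕ.suc n} v = cong (v zero +₃_) (sum₃≡sum (v ∘ suc))

module _ {n} {f : (Fin n → Fin 3) → Fin 4} (f-poly : IsPolymorphism 3 4 n f) where

  onBlocks : (A B C : Fin n → Bool) → Shape → Fin 4
  onBlocks A B C h = f (λ i → h (A i) (B i) (C i))

  onBlocks-hom : ∀ {A B C} → (∀ i → OneHot (A i) (B i) (C i)) →
                 ∀ {h₁ h₂ h₃} → Compatible h₁ h₂ h₃ →
                 LO 4 (onBlocks A B C h₁) (onBlocks A B C h₂) (onBlocks A B C h₃)
  onBlocks-hom partition compat = f-poly _ _ _ λ i → compat (partition i)

  favours-partition : ∀ {A B C} → (∀ i → OneHot (A i) (B i) (C i)) →
                      (favours f A +₃ favours f B) +₃ favours f C ≡ 1₃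
  favours-partition {A} {B} {C} partition =
    conclude (explore-sound (annotate [] phase₁) {k = verdict} [] certificate)
    where
    open Soundness (onBlocks A B C) (onBlocks-hom partition)
    values : List (Fin 4)
    values = map (onBlocks A B C ∘ proj₁) (annotate [] phase₁)
    agreeing-not-refuted : ∀ {σ} → Agrees σ → ¬ T (refutes σ)
    agreeing-not-refuted ag r = Equivalence.from T-≡ (proj₂ (proj₂
      (explore-sound (annotate (reverse phase₁) phase₂) {k = λ _ _ → false} ag (Equivalence.to T-≡ r))))
    conclude : ∃[ σ ] Agrees σ × verdict σ values ≡ true → (favours f A +₃ favours f B) +₃ favours f C ≡ 1₃
    conclude (σ , σ-agrees , t) =
      [ toWitness , ⊥-elim ∘ agreeing-not-refuted σ-agrees ]′
        (Equivalence.to (T-∨ {sumsToOne values}) (Equivalence.from T-≡ t))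

  favours-∅ : favours f ∅ ≡ 0₃
  favours-∅ = cong bit (dec-false (_ <? _) (<-asym (polymorphism-monotone f-poly λ _ → ℕ.z<s)))

  favours-full : favours f (λ _ → true) ≡ 1₃
  favours-full = cong bit (dec-true (_ <? _) (polymorphism-monotone f-poly λ _ → ℕ.z<s))

  favours-additive : IsAdditive (favours f)
  favours-additive = record { cong-≗ = cong-≗ ; empty = favours-∅ ; union = union }
    where
    cong-≗ : ∀ {S S′} → S ≗ S′ → favours f S ≡ favours f S′
    cong-≗ {S} {S′} S≗S′ = +₃-cancelʳ _ _ _ (+₃-cancelʳ _ _ _ (trans
      (favours-partition λ i → oneHot-∁ (S i))
      (sym (favours-partition λ i → subst (λ b → OneHot b false (not (S i))) (S≗S′ i) (oneHot-∁ (S i))))))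
    union : ∀ {S S′} → Disjoint S S′ → favours f (S ∪ S′) ≡ favours f S +₃ favours f S′
    union {S} {S′} disjoint = begin
      favours f (S ∪ S′)                   ≡⟨ sym (+-identityʳ _) ⟩
      favours f (S ∪ S′) +₃ 0₃             ≡⟨ cong (favours f (S ∪ S′) +₃_) (sym favours-∅) ⟩
      favours f (S ∪ S′) +₃ favours f ∅    ≡⟨ +₃-cancelʳ _ _ _ (trans
                                                (favours-partition λ i → oneHot-∁ ((S ∪ S′) i))
                                                (sym (favours-partition λ i → oneHot-∪ (S i) (S′ i) (disjoint i)))) ⟩
      favours f S +₃ favours f S′          ∎
      where open ≡-Reasoning

  sum₃-favours-singletons : sum₃ (λ k → favours f ⁅ k ⁆) ≡ 1₃
  sum₃-favours-singletons = begin
    sum₃ (λ k → favours f ⁅ k ⁆)  ≡⟨ sum₃≡sum (λ k → favours f ⁅ k ⁆) ⟩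
    sum (λ k → favours f ⁅ k ⁆)   ≡⟨ sym (additive⇒sum favours-additive (λ _ → true)) ⟩
    favours f (λ _ → true)        ≡⟨ favours-full ⟩
    1₃                            ∎
    where open ≡-Reasoning

χ : (n : ℕ) → Pol 3 4 (ℕ.suc n) → Z3 (ℕ.suc n)
χ n (f , f-poly) = (λ k → favours f ⁅ k ⁆) , sum₃-favours-singletons f-poly

χ-preserves-minors : IsMinionHom 3 4 χ
χ-preserves-minors n m π (f , f-poly) y = begin
  sum₃ (λ j → favours f (⁅ j ⁆ ∘ π) *₃ y j)
    ≡⟨ sum₃≡sum (λ j → favours f (⁅ j ⁆ ∘ π) *₃ y j) ⟩
  sum (λ j → favours f (⁅ j ⁆ ∘ π) *₃ y j)
    ≡⟨ sum-cong-≗ (λ j → cong (_*₃ y j) (additive⇒sum (favours-additive f-poly) (⁅ j ⁆ ∘ π))) ⟩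
  sum (λ j → sum (λ i → if ⁅ j ⁆ (π i) then α i else 0₃) *₃ y j)
    ≡⟨ ∑-fibres π α y ⟩
  sum (λ i → α i *₃ y (π i))
    ≡⟨ sum₃≡sum (λ i → α i *₃ y (π i)) ⟨
  sum₃ (λ i → α i *₃ y (π i))
    ∎
  where
  open ≡-Reasoning
  α : Fin (ℕ.suc n) → Fin 3
  α k = favours f ⁅ k ⁆

lemma3p2 : MinionHom 3 4
lemma3p2 = χ , χ-preserves-minors
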